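{- Let $p$ be an odd prime, $r\ge1$, and let $z^i\sigma$ be an element of $K(p^r)$. Put $\alpha=v_p(\sigma-1)$ and $\beta=v_p(i)$ (both in $\{0,\dots,r\}$). Then the conjugacy class of $z^i\sigma$ in $K(p^r)$ is $$[z^i\sigma]=\begin{cases}\{z^j\sigma: v_p(j)=\beta\} & \text{if } 0\le\beta<\alpha,\\ \{z^j\sigma: v_p(j)\ge\alpha\} & \text{if } \alpha\le\beta.\end{cases}$$
   Context: $K(p^r)$ is the group of elements $z^j\sigma$ with $j\in\mathbb{Z}/p^r\mathbb{Z}$, $\sigma\in(\mathbb{Z}/p^r\mathbb{Z})^*$ and multiplication $z^i\sigma\,z^j\tau=z^{i+\sigma j}\sigma\tau$. For $x\in\mathbb{Z}/p^r\mathbb{Z}$, $v_p(x)\in\{0,\dots,r\}$ is the $p$-adic valuation of a representative, with $v_p(0)=r$. -}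

module Defs where

open import Data.Nat using (ℕ; zero; suc; _+_; _*_; _^_; _<_; _%_)
open import Data.Nat.Divisibility using (_∣?_)
open import Data.Nat.Coprimality using (Coprime)
open import Data.Product using (_×_; _,_; Σ; ∃)
open import Relation.Nullary using (yes; no)
open import Relation.Binary.PropositionalEquality using (_≡_)

-- reduction modulo n (identity for n = 0; only used with n = p^r ≥ 3)
mod : ℕ → ℕ → ℕ
mod x zero    = x
mod x (suc n) = x % suc n

-- p-adic valuation of x ∈ ℤ/p^r, capped at r:
-- the largest k ≤ r with p^k ∣ x  (so vp p r 0 = r)
vp : ℕ → ℕ → ℕ → ℕ
vp p zero    x = 0
vp p (suc k) x with (p ^ suc k) ∣? x
... | yes _ = suc k
... | no  _ = vp p k x

-- elements z^j σ of K(N) encoded as pairs (j , σ) of representatives in [0, N)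
IsElt : ℕ → ℕ × ℕ → Set
IsElt N (j , σ) = j < N × σ < N × Coprime σ N

-- z^i σ · z^j τ = z^(i + σ j) σ τ
mulK : ℕ → ℕ × ℕ → ℕ × ℕ → ℕ × ℕ
mulK N (i , σ) (j , τ) = (mod (i + σ * j) N , mod (σ * τ) N)

-- y is conjugate to x in K(N): y = g x g⁻¹ for some g ∈ K(N)
-- (h is the inverse of g: h g = identity z^0 1)
Conj : ℕ → ℕ × ℕ → ℕ × ℕ → Set
Conj N x y =
  Σ (ℕ × ℕ) λ g → Σ (ℕ × ℕ) λ h →
    IsElt N g × IsElt N h × mulK N h g ≡ (0 , 1) × mulK N g h ≡ (0 , 1) ×
    y ≡ mulK N (mulK N g x) h

-- Conjugating z^i σ by z^k γ gives z^(γ i + (1 - σ) k) σ, so the class of z^i σ consists of the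
-- z^j σ with j ≡ γ (i + l (σ - 1)) for a unit γ and an arbitrary l.  Multiplication by a unit
-- preserves p-adic valuations, and l (σ - 1) runs through all multiples of p^α.  Hence
-- divisibility of the exponent by p^k, k ≤ α, is a conjugacy invariant, which pins down the
-- valuation when it is below α; and when both valuations are at least α, the difference j - i is
-- a multiple of p^α and can be absorbed by l (σ - 1) with γ = 1.
module Submission where

open import Data.Nat.Base as ℕ using (ℕ; zero; suc; _≤_; _<_; _∸_; _^_)
import Data.Nat.Properties as ℕ
open import Data.Nat.Divisibility as ℕ using (_∣_)
import Data.Nat.DivMod as ℕ
open import Data.Nat.Coprimality using (Coprime; coprime-Bézout; coprime-divisor; 0-coprimeTo-m⇒m≡1)
open import Data.Nat.GCD using (module Bézout)
open import Data.Nat.Primality using (Prime; prime⇒irreducible; prime⇒nonTrivial)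
open import Data.Integer.Base using (ℤ; +_; 0ℤ; 1ℤ; _+_; _*_; _-_; -_; ∣_∣; _⊖_)
import Data.Integer.Properties as ℤ
open import Data.Integer.DivMod using (_%ℕ_; _/ℕ_; n%ℕd<d; a≡a%ℕn+[a/ℕn]*n)
open import Data.Integer.Divisibility.Signed
  using (divides; ∣ᵤ⇒∣; ∣⇒∣ᵤ; ∣-trans; ∣m∣n⇒∣m+n; ∣m∣n⇒∣m-n; ∣m⇒∣-m; ∣n⇒∣m*n; ∣m⇒∣m*n)
  renaming (_∣_ to _∣ᶻ_)
open import Data.Integer.Tactic.RingSolver using (solve-∀)
open import Data.Product.Base using (_×_; _,_; ∃; ∃₂; proj₁; proj₂)
open import Data.Product.Relation.Binary.Pointwise.NonDependent using (Pointwise; ×-setoid)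
open import Data.Product.Function.NonDependent.Propositional using (_×-⇔_)
open import Data.Sum.Base using (inj₁; inj₂)
open import Function.Bundles using (_⇔_; mk⇔)
open import Function.Construct.Composition using (_⇔-∘_)
open import Function.Construct.Identity using (⇔-id)
open import Relation.Nullary using (¬_; contradiction; yes; no)
open import Relation.Binary.Bundles using (Setoid)
open import Relation.Binary.Structures using (IsEquivalence)
import Relation.Binary.Reasoning.Setoid as ≈-Reasoning
open import Relation.Binary.PropositionalEquality
  using (_≡_; refl; sym; trans; cong; cong₂; subst; module ≡-Reasoning)
open Bézout.Identity using (+-; -+)
open import Defs

infix 4 _≡[_]_

record _≡[_]_ (a : ℤ) (n : ℕ) (b : ℤ) : Set where
  constructor mod∣
  field ∣-diff : + n ∣ᶻ a - b

∣ᶻ-resp-≡ : ∀ {k a b} → a ≡ b → k ∣ᶻ a → k ∣ᶻ b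
∣ᶻ-resp-≡ refl k∣a = k∣a

module _ {n : ℕ} where

  mod-reflexive : ∀ {a b} → a ≡ b → a ≡[ n ] b
  mod-reflexive {a} refl = mod∣ (∣ᶻ-resp-≡ (sym (ℤ.+-inverseʳ a)) (divides 0ℤ refl))

  mod-sym : ∀ {a b} → a ≡[ n ] b → b ≡[ n ] a
  mod-sym {a} {b} (mod∣ n∣a-b) = mod∣ (∣ᶻ-resp-≡ (lemma a b) (∣m⇒∣-m n∣a-b))
    where lemma : ∀ a b → - (a - b) ≡ b - a
          lemma = solve-∀

  mod-trans : ∀ {a b c} → a ≡[ n ] b → b ≡[ n ] c → a ≡[ n ] c
  mod-trans {a} {b} {c} (mod∣ p) (mod∣ q) = mod∣ (∣ᶻ-resp-≡ (lemma a b c) (∣m∣n⇒∣m+n p q))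
    where lemma : ∀ a b c → (a - b) + (b - c) ≡ a - c
          lemma = solve-∀

  mod-isEquivalence : IsEquivalence (_≡[ n ]_)
  mod-isEquivalence = record { refl = mod-reflexive refl ; sym = mod-sym ; trans = mod-trans }

  -‿cong-mod : ∀ {a b} → a ≡[ n ] b → - a ≡[ n ] - b
  -‿cong-mod {a} {b} (mod∣ p) = mod∣ (∣ᶻ-resp-≡ (lemma a b) (∣m⇒∣-m p))
    where lemma : ∀ a b → - (a - b) ≡ - a - - b
          lemma = solve-∀

  +-cong-mod : ∀ {a b c d} → a ≡[ n ] b → c ≡[ n ] d → a + c ≡[ n ] b + d
  +-cong-mod {a} {b} {c} {d} (mod∣ p) (mod∣ q) = mod∣ (∣ᶻ-resp-≡ (lemma a b c d) (∣m∣n⇒∣m+n p q))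
    where lemma : ∀ a b c d → (a - b) + (c - d) ≡ (a + c) - (b + d)
          lemma = solve-∀

  *-cong-mod : ∀ {a b c d} → a ≡[ n ] b → c ≡[ n ] d → a * c ≡[ n ] b * d
  *-cong-mod {a} {b} {c} {d} (mod∣ p) (mod∣ q) =
    mod∣ (∣ᶻ-resp-≡ (lemma a b c d) (∣m∣n⇒∣m+n (∣n⇒∣m*n a q) (∣m⇒∣m*n d p)))
    where lemma : ∀ a b c d → a * (c - d) + (a - b) * d ≡ a * c - b * d
          lemma = solve-∀

  +-congˡ-mod : ∀ a {b c} → b ≡[ n ] c → a + b ≡[ n ] a + c
  +-congˡ-mod a = +-cong-mod (mod-reflexive {a} refl)

  +-congʳ-mod : ∀ c {a b} → a ≡[ n ] b → a + c ≡[ n ] b + c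
  +-congʳ-mod c a≡b = +-cong-mod a≡b (mod-reflexive {c} refl)

  *-congˡ-mod : ∀ a {b c} → b ≡[ n ] c → a * b ≡[ n ] a * c
  *-congˡ-mod a = *-cong-mod (mod-reflexive {a} refl)

  *-congʳ-mod : ∀ c {a b} → a ≡[ n ] b → a * c ≡[ n ] b * c
  *-congʳ-mod c a≡b = *-cong-mod a≡b (mod-reflexive {c} refl)

mod-setoid : ℕ → Setoid _ _
mod-setoid n = record { isEquivalence = mod-isEquivalence {n} }

mod-intro : ∀ {n a b} q → a ≡ b + q * + n → a ≡[ n ] b
mod-intro {n} {a} {b} q refl = mod∣ (divides q (lemma b q (+ n)))
  where lemma : ∀ b q n → b + q * n - b ≡ q * n
        lemma = solve-∀

pos-+-* : ∀ a b c → + (a ℕ.+ b ℕ.* c) ≡ + a + + b * + c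
pos-+-* a b c = trans (ℤ.pos-+ a (b ℕ.* c)) (cong (λ t → + a + t) (ℤ.pos-* b c))

%ℕ-mod : ∀ a n .{{_ : ℕ.NonZero n}} → + (a %ℕ n) ≡[ n ] a
%ℕ-mod a n = mod-sym (mod-intro (a /ℕ n) (a≡a%ℕn+[a/ℕn]*n a n))

mod-mod : ∀ x n → + mod x n ≡[ n ] + x
mod-mod x zero    = mod-reflexive refl
mod-mod x (suc n) = mod-sym (mod-intro (+ (x ℕ./ suc n)) (begin
  + x                                          ≡⟨ cong +_ (ℕ.m≡m%n+[m/n]*n x (suc n)) ⟩
  + (x ℕ.% suc n ℕ.+ x ℕ./ suc n ℕ.* suc n)    ≡⟨ pos-+-* (x ℕ.% suc n) (x ℕ./ suc n) (suc n) ⟩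
  + mod x (suc n) + + (x ℕ./ suc n) * + suc n  ∎))
  where open ≡-Reasoning

mod-< : ∀ x {n} → 0 < n → mod x n < n
mod-< x {suc n} _ = ℕ.m%n<n x (suc n)

∣∧<⇒≡0 : ∀ {m n} → n ∣ m → m < n → m ≡ 0
∣∧<⇒≡0 {zero}  _   _   = refl
∣∧<⇒≡0 {suc m} n∣m m<n = contradiction n∣m (ℕ.>⇒∤ m<n)

mod-injective : ∀ {n x y} → x < n → y < n → + x ≡[ n ] + y → x ≡ y
mod-injective {n} {x} {y} x<n y<n (mod∣ n∣x-y) =
  ℤ.+-injective (ℤ.i-j≡0⇒i≡j (+ x) (+ y) (ℤ.∣i∣≡0⇒i≡0 (∣∧<⇒≡0 (∣⇒∣ᵤ n∣x-y) ∣x-y∣<n)))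
  where
  ∣x-y∣<n : ∣ + x - + y ∣ < n
  ∣x-y∣<n = begin-strict
    ∣ + x - + y ∣ ≡⟨ cong ∣_∣ (ℤ.m-n≡m⊖n x y) ⟩
    ∣ x ⊖ y ∣     ≤⟨ ℤ.∣m⊝n∣≤m⊔n x y ⟩
    x ℕ.⊔ y       <⟨ ℕ.⊔-lub x<n y<n ⟩
    n             ∎
    where open ℕ.≤-Reasoning

∣ᶻ-resp-mod : ∀ {m n a b} → m ∣ n → a ≡[ n ] b → + m ∣ᶻ a → + m ∣ᶻ b
∣ᶻ-resp-mod {a = a} {b} m∣n (mod∣ n∣a-b) m∣a =
  ∣ᶻ-resp-≡ (lemma a b) (∣m∣n⇒∣m-n m∣a (∣-trans (∣ᵤ⇒∣ m∣n) n∣a-b))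
  where lemma : ∀ a b → a - (a - b) ≡ b
        lemma = solve-∀

Unit : ℕ → ℤ → Set
Unit n a = ∃ λ b → a * b ≡[ n ] 1ℤ

module _ {n : ℕ} where

  unit-* : ∀ {a b} → Unit n a → Unit n b → Unit n (a * b)
  unit-* {a} {b} (a⁻¹ , aa⁻¹≡1) (b⁻¹ , bb⁻¹≡1) = a⁻¹ * b⁻¹ , (begin
    a * b * (a⁻¹ * b⁻¹)   ≡⟨ lemma a b a⁻¹ b⁻¹ ⟩
    (a * a⁻¹) * (b * b⁻¹) ≈⟨ *-cong-mod aa⁻¹≡1 bb⁻¹≡1 ⟩
    1ℤ                    ∎)
    where
    open ≈-Reasoning (mod-setoid n)
    lemma : ∀ a b c d → a * b * (c * d) ≡ (a * c) * (b * d)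
    lemma = solve-∀

  unit-resp-mod : ∀ {a b} → a ≡[ n ] b → Unit n b → Unit n a
  unit-resp-mod a≡b (b⁻¹ , bb⁻¹≡1) = b⁻¹ , mod-trans (*-congʳ-mod b⁻¹ a≡b) bb⁻¹≡1

  unit-inverse : ∀ a b → a * b ≡[ n ] 1ℤ → Unit n b
  unit-inverse a b ab≡1 = a , mod-trans (mod-reflexive (ℤ.*-comm b a)) ab≡1

coprime⇒unit : ∀ {x n} → Coprime x n → Unit n (+ x)
coprime⇒unit {x} {n} x⊥n with coprime-Bézout x⊥n
... | +- u v 1+vn≡ux = + u , mod-intro (+ v) (begin
  + x * + u         ≡⟨ ℤ.*-comm (+ x) (+ u) ⟩
  + u * + x         ≡⟨ ℤ.pos-* u x ⟨
  + (u ℕ.* x)       ≡⟨ cong +_ 1+vn≡ux ⟨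
  + (1 ℕ.+ v ℕ.* n) ≡⟨ pos-+-* 1 v n ⟩
  1ℤ + + v * + n    ∎)
  where open ≡-Reasoning
... | -+ u v 1+ux≡vn = - + u , mod-intro (- + v) (begin
  + x * - + u           ≡⟨ lemma₁ (+ x) (+ u) ⟩
  1ℤ - (1ℤ + + u * + x) ≡⟨ cong (λ t → 1ℤ - t) (trans (sym (pos-+-* 1 u x)) (cong +_ 1+ux≡vn)) ⟩
  1ℤ - + (v ℕ.* n)      ≡⟨ cong (λ t → 1ℤ - t) (ℤ.pos-* v n) ⟩
  1ℤ - + v * + n        ≡⟨ lemma₂ (+ v) (+ n) ⟩
  1ℤ + - + v * + n      ∎)
  where
  open ≡-Reasoning
  lemma₁ : ∀ x u → x * - u ≡ 1ℤ - (1ℤ + u * x)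
  lemma₁ = solve-∀
  lemma₂ : ∀ v n → 1ℤ - v * n ≡ 1ℤ + - v * n
  lemma₂ = solve-∀

unit⇒coprime : ∀ {x n} → Unit n (+ x) → Coprime x n
unit⇒coprime {x} {n} (x⁻¹ , xx⁻¹≡1) (d∣x , d∣n) =
  ℕ.∣1⇒≡1 (∣⇒∣ᵤ (∣ᶻ-resp-mod d∣n xx⁻¹≡1 (∣m⇒∣m*n {m = + x} x⁻¹ (∣ᵤ⇒∣ d∣x))))

-- K(n) is the image of the monoid ℤ ⋊ (ℤ , *) below under reduction modulo n in both
-- coordinates; ⟦_⟧ lifts the reduced representatives used by mulK.
infixl 7 _·_
infix 4 _≈[_]_

_·_ : ℤ × ℤ → ℤ × ℤ → ℤ × ℤ
(a , b) · (c , d) = (a + b * c , b * d)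

⟦_⟧ : ℕ × ℕ → ℤ × ℤ
⟦ a , b ⟧ = (+ a , + b)

_≈[_]_ : ℤ × ℤ → ℕ → ℤ × ℤ → Set
x ≈[ n ] y = Pointwise _≡[ n ]_ _≡[ n ]_ x y

pair-setoid : ℕ → Setoid _ _
pair-setoid n = ×-setoid (mod-setoid n) (mod-setoid n)

·-cong : ∀ {n x x′ y y′} → x ≈[ n ] x′ → y ≈[ n ] y′ → x · y ≈[ n ] x′ · y′
·-cong {x = _ , _} {_ , _} {_ , _} {_ , _} (a≡a′ , b≡b′) (c≡c′ , d≡d′) =
  +-cong-mod a≡a′ (*-cong-mod b≡b′ c≡c′) , *-cong-mod b≡b′ d≡d′

⟦mulK⟧ : ∀ n x y → ⟦ mulK n x y ⟧ ≈[ n ] ⟦ x ⟧ · ⟦ y ⟧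
⟦mulK⟧ n (a , b) (c , d) =
  mod-trans (mod-mod _ n) (mod-reflexive (pos-+-* a b c)) ,
  mod-trans (mod-mod _ n) (mod-reflexive (ℤ.pos-* b d))

⟦mulK₃⟧ : ∀ n x y z → ⟦ mulK n (mulK n x y) z ⟧ ≈[ n ] ⟦ x ⟧ · ⟦ y ⟧ · ⟦ z ⟧
⟦mulK₃⟧ n x y z = ≈.trans (⟦mulK⟧ n (mulK n x y) z) (·-cong (⟦mulK⟧ n x y) ≈.refl)
  where module ≈ = Setoid (pair-setoid n)

⟦⟧-injective : ∀ {n a b c d} → a < n → b < n → c < n → d < n →
               ⟦ a , b ⟧ ≈[ n ] ⟦ c , d ⟧ → (a , b) ≡ (c , d)
⟦⟧-injective a<n b<n c<n d<n (a≡c , b≡d) =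
  cong₂ _,_ (mod-injective a<n c<n a≡c) (mod-injective b<n d<n b≡d)

-- z^i σ and z^j σ are conjugate in K(n) iff ConjExp n (σ - 1) i j.
ConjExp : (n s i j : ℕ) → Set
ConjExp n s i j = ∃₂ λ γ l → Unit n γ × + j ≡[ n ] γ * (+ i + l * + s)

module _ {n s : ℕ} where

  ConjExp-sym : ∀ {i j} → ConjExp n s i j → ConjExp n s j i
  ConjExp-sym {i} {j} (γ , l , (γ⁻¹ , γγ⁻¹≡1) , j≡) =
    γ⁻¹ , - (γ * l) , unit-inverse γ γ⁻¹ γγ⁻¹≡1 , mod-sym (begin
      γ⁻¹ * (+ j + - (γ * l) * + s)                 ≈⟨ *-congˡ-mod γ⁻¹ (+-congʳ-mod (- (γ * l) * + s) j≡) ⟩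
      γ⁻¹ * (γ * (+ i + l * + s) + - (γ * l) * + s) ≡⟨ lemma γ⁻¹ γ (+ i) l (+ s) ⟩
      (γ * γ⁻¹) * + i                               ≈⟨ *-congʳ-mod (+ i) γγ⁻¹≡1 ⟩
      1ℤ * + i                                      ≡⟨ ℤ.*-identityˡ (+ i) ⟩
      + i                                           ∎)
    where
    open ≈-Reasoning (mod-setoid n)
    lemma : ∀ γ⁻¹ γ i l s → γ⁻¹ * (γ * (i + l * s) + - (γ * l) * s) ≡ (γ * γ⁻¹) * i
    lemma = solve-∀

  ConjExp-pres-∣ : ∀ {m i j} → m ∣ n → m ∣ s → ConjExp n s i j → m ∣ i → m ∣ j
  ConjExp-pres-∣ {i = i} m∣n m∣s (γ , l , _ , j≡) m∣i = ∣⇒∣ᵤ (∣ᶻ-resp-mod m∣n (mod-sym j≡)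
    (∣n⇒∣m*n γ (∣m∣n⇒∣m+n (∣ᵤ⇒∣ {i = + i} m∣i) (∣n⇒∣m*n l (∣ᵤ⇒∣ {i = + s} m∣s)))))

pos-∸1 : ∀ {σ n} → 1 < n → Coprime σ n → + (σ ∸ 1) ≡ + σ - 1ℤ
pos-∸1 {zero}  1<n 0⊥n = contradiction (0-coprimeTo-m⇒m≡1 0⊥n) (ℕ.>⇒≢ 1<n)
pos-∸1 {suc σ} _   _   = sym (ℤ.m-n≡m⊖n (suc σ) 1)

module _ {n : ℕ} (1<n : 1 < n) where

  private
    0<n : 0 < n
    0<n = ℕ.<⇒≤ 1<n

  conj⇒ : ∀ {i σ j τ} → IsElt n (i , σ) → Conj n (i , σ) (j , τ) →
          IsElt n (j , τ) × τ ≡ σ × ConjExp n (σ ∸ 1) i j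
  conj⇒ {i} {σ} {j} {τ} (_ , σ<n , σ⊥n) ((k , γ) , (l , η) , _ , _ , _ , gh≡e , y≡gxh) =
    (j<n , τ<n , subst (λ t → Coprime t n) (sym τ≡σ) σ⊥n) , τ≡σ , (+ γ , + l , (+ η , γη≡1) , j≡)
    where
    open ≈-Reasoning (mod-setoid n)
    gh : ⟦ 0 , 1 ⟧ ≈[ n ] ⟦ k , γ ⟧ · ⟦ l , η ⟧
    gh = subst (λ z → ⟦ z ⟧ ≈[ n ] _) gh≡e (⟦mulK⟧ n (k , γ) (l , η))
    gxh : ⟦ j , τ ⟧ ≈[ n ] ⟦ k , γ ⟧ · ⟦ i , σ ⟧ · ⟦ l , η ⟧
    gxh = subst (λ z → ⟦ z ⟧ ≈[ n ] _) (sym y≡gxh) (⟦mulK₃⟧ n (k , γ) (i , σ) (l , η))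
    γη≡1 : + γ * + η ≡[ n ] 1ℤ
    γη≡1 = mod-sym (proj₂ gh)
    j≡ : + j ≡[ n ] + γ * (+ i + + l * + (σ ∸ 1))
    j≡ = begin
      + j                                           ≈⟨ proj₁ gxh ⟩
      + k + + γ * + i + + γ * + σ * + l             ≡⟨ lemma (+ k) (+ γ) (+ i) (+ σ) (+ l) ⟩
      (+ k + + γ * + l) + + γ * (+ i + + l * (+ σ - 1ℤ)) ≈⟨ +-congʳ-mod _ (mod-sym (proj₁ gh)) ⟩
      0ℤ + + γ * (+ i + + l * (+ σ - 1ℤ))           ≡⟨ ℤ.+-identityˡ _ ⟩
      + γ * (+ i + + l * (+ σ - 1ℤ))                ≡⟨ cong (λ t → + γ * (+ i + + l * t)) (pos-∸1 1<n σ⊥n) ⟨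
      + γ * (+ i + + l * + (σ ∸ 1))                 ∎
      where lemma : ∀ k γ i σ l → k + γ * i + γ * σ * l ≡ (k + γ * l) + γ * (i + l * (σ - 1ℤ))
            lemma = solve-∀
    τ<n : τ < n
    τ<n = subst (_< n) (sym (cong proj₂ y≡gxh)) (mod-< _ 0<n)
    j<n : j < n
    j<n = subst (_< n) (sym (cong proj₁ y≡gxh)) (mod-< _ 0<n)
    τ≡σ : τ ≡ σ
    τ≡σ = mod-injective τ<n σ<n (begin
      + τ                   ≈⟨ proj₂ gxh ⟩
      + γ * + σ * + η       ≡⟨ lemma (+ γ) (+ σ) (+ η) ⟩
      + σ * (+ γ * + η)     ≈⟨ *-congˡ-mod (+ σ) γη≡1 ⟩
      + σ * 1ℤ              ≡⟨ ℤ.*-identityʳ (+ σ) ⟩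
      + σ                   ∎)
      where lemma : ∀ γ σ η → γ * σ * η ≡ σ * (γ * η)
            lemma = solve-∀

  ⇒conj : ∀ {i σ j} → IsElt n (i , σ) → j < n → ConjExp n (σ ∸ 1) i j → Conj n (i , σ) (j , σ)
  ⇒conj {i} {σ} {j} (_ , σ<n , σ⊥n) j<n (γ , l , (γ⁻¹ , γγ⁻¹≡1) , j≡) =
    g , h , g∈K , h∈K ,
    ⟦⟧-injective (mod-< _ 0<n) (mod-< _ 0<n) 0<n 1<n hg≈e ,
    ⟦⟧-injective (mod-< _ 0<n) (mod-< _ 0<n) 0<n 1<n gh≈e ,
    sym (⟦⟧-injective (mod-< _ 0<n) (mod-< _ 0<n) j<n σ<n gxh≈y)
    where
    instance _ = ℕ.>-nonZero 0<n
    reduce : ℤ → ℕ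
    reduce a = a %ℕ n
    reduce-< : ∀ a → reduce a < n
    reduce-< a = n%ℕd<d a n
    g h : ℕ × ℕ
    g = reduce (- (γ * l)) , reduce γ
    h = reduce l , reduce γ⁻¹
    g∈K : IsElt n g
    g∈K = reduce-< (- (γ * l)) , reduce-< γ ,
          unit⇒coprime (unit-resp-mod (%ℕ-mod γ n) (γ⁻¹ , γγ⁻¹≡1))
    h∈K : IsElt n h
    h∈K = reduce-< l , reduce-< γ⁻¹ ,
          unit⇒coprime (unit-resp-mod (%ℕ-mod γ⁻¹ n) (unit-inverse γ γ⁻¹ γγ⁻¹≡1))
    ⟦g⟧ : ⟦ g ⟧ ≈[ n ] (- (γ * l) , γ)
    ⟦g⟧ = %ℕ-mod _ n , %ℕ-mod _ n
    ⟦h⟧ : ⟦ h ⟧ ≈[ n ] (l , γ⁻¹)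
    ⟦h⟧ = %ℕ-mod _ n , %ℕ-mod _ n
    γ⁻¹γ≡1 : γ⁻¹ * γ ≡[ n ] 1ℤ
    γ⁻¹γ≡1 = mod-trans (mod-reflexive (ℤ.*-comm γ⁻¹ γ)) γγ⁻¹≡1
    hg≈e : ⟦ mulK n h g ⟧ ≈[ n ] ⟦ 0 , 1 ⟧
    hg≈e = begin
      ⟦ mulK n h g ⟧                   ≈⟨ ⟦mulK⟧ n h g ⟩
      ⟦ h ⟧ · ⟦ g ⟧                    ≈⟨ ·-cong ⟦h⟧ ⟦g⟧ ⟩
      (l + γ⁻¹ * - (γ * l) , γ⁻¹ * γ)  ≈⟨ first , γ⁻¹γ≡1 ⟩
      ⟦ 0 , 1 ⟧                        ∎
      where
      open ≈-Reasoning (pair-setoid n)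
      lemma : ∀ l γ γ⁻¹ → l + γ⁻¹ * - (γ * l) ≡ l + - (l * (γ * γ⁻¹))
      lemma = solve-∀
      first : l + γ⁻¹ * - (γ * l) ≡[ n ] 0ℤ
      first = mod-trans (mod-reflexive (lemma l γ γ⁻¹))
        (mod-trans (+-congˡ-mod l (-‿cong-mod (*-congˡ-mod l γγ⁻¹≡1)))
          (mod-reflexive (trans (cong (λ t → l + - t) (ℤ.*-identityʳ l)) (ℤ.+-inverseʳ l))))
    gh≈e : ⟦ mulK n g h ⟧ ≈[ n ] ⟦ 0 , 1 ⟧
    gh≈e = begin
      ⟦ mulK n g h ⟧                        ≈⟨ ⟦mulK⟧ n g h ⟩
      ⟦ g ⟧ · ⟦ h ⟧                         ≈⟨ ·-cong ⟦g⟧ ⟦h⟧ ⟩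
      (- (γ * l) + γ * l , γ * γ⁻¹)         ≈⟨ mod-reflexive (ℤ.+-inverseˡ (γ * l)) , γγ⁻¹≡1 ⟩
      ⟦ 0 , 1 ⟧                             ∎
      where open ≈-Reasoning (pair-setoid n)
    gxh≈y : ⟦ mulK n (mulK n g (i , σ)) h ⟧ ≈[ n ] ⟦ j , σ ⟧
    gxh≈y = begin
      ⟦ mulK n (mulK n g (i , σ)) h ⟧       ≈⟨ ⟦mulK₃⟧ n g (i , σ) h ⟩
      ⟦ g ⟧ · ⟦ i , σ ⟧ · ⟦ h ⟧             ≈⟨ ·-cong (·-cong ⟦g⟧ (mod-reflexive refl , mod-reflexive refl)) ⟦h⟧ ⟩
      (- (γ * l) , γ) · ⟦ i , σ ⟧ · (l , γ⁻¹) ≈⟨ first , second ⟩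
      ⟦ j , σ ⟧                             ∎
      where
      open ≈-Reasoning (pair-setoid n)
      lemma₁ : ∀ γ l i σ → - (γ * l) + γ * i + γ * σ * l ≡ γ * (i + l * (σ - 1ℤ))
      lemma₁ = solve-∀
      lemma₂ : ∀ γ σ γ⁻¹ → γ * σ * γ⁻¹ ≡ σ * (γ * γ⁻¹)
      lemma₂ = solve-∀
      first : - (γ * l) + γ * + i + γ * + σ * l ≡[ n ] + j
      first = mod-trans (mod-reflexive (trans (lemma₁ γ l (+ i) (+ σ))
                (cong (λ t → γ * (+ i + l * t)) (sym (pos-∸1 1<n σ⊥n))))) (mod-sym j≡)
      second : γ * + σ * γ⁻¹ ≡[ n ] + σ
      second = mod-trans (mod-reflexive (lemma₂ γ (+ σ) γ⁻¹))
                 (mod-trans (*-congˡ-mod (+ σ) γγ⁻¹≡1) (mod-reflexive (ℤ.*-identityʳ (+ σ))))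

  conj⇔ : ∀ {i σ j τ} → IsElt n (i , σ) →
          Conj n (i , σ) (j , τ) ⇔ (IsElt n (j , τ) × τ ≡ σ × ConjExp n (σ ∸ 1) i j)
  conj⇔ x∈K = mk⇔ (conj⇒ x∈K) λ { ((j<n , _) , refl , c) → ⇒conj x∈K j<n c }

module _ (p : ℕ) where

  vp≤ : ∀ r x → vp p r x ≤ r
  vp≤ zero    x = ℕ.z≤n
  vp≤ (suc r) x with p ^ suc r ℕ.∣? x
  ... | yes _ = ℕ.≤-refl
  ... | no  _ = ℕ.m≤n⇒m≤1+n (vp≤ r x)

  p^vp∣ : ∀ r x → p ^ vp p r x ∣ x
  p^vp∣ zero    x = ℕ.1∣ x
  p^vp∣ (suc r) x with p ^ suc r ℕ.∣? x
  ... | yes p^r∣x = p^r∣x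
  ... | no  _     = p^vp∣ r x

  p^k∣⇒k≤vp : ∀ {r x k} → k ≤ r → p ^ k ∣ x → k ≤ vp p r x
  p^k∣⇒k≤vp {zero}  ℕ.z≤n _ = ℕ.z≤n
  p^k∣⇒k≤vp {suc r} {x} {k} k≤1+r p^k∣x with p ^ suc r ℕ.∣? x
  ... | yes _ = k≤1+r
  ... | no p^r∤x with ℕ.m≤n⇒m<n∨m≡n k≤1+r
  ...   | inj₁ k<1+r = p^k∣⇒k≤vp (ℕ.s≤s⁻¹ k<1+r) p^k∣x
  ...   | inj₂ refl  = contradiction p^k∣x p^r∤x

  p^-mono-∣ : ∀ {a b} → a ≤ b → p ^ a ∣ p ^ b
  p^-mono-∣ {a} {b} a≤b = ℕ.divides (p ^ (b ∸ a)) (begin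
    p ^ b               ≡⟨ cong (p ^_) (ℕ.m∸n+n≡m a≤b) ⟨
    p ^ (b ∸ a ℕ.+ a)   ≡⟨ ℕ.^-distribˡ-+-* p (b ∸ a) a ⟩
    p ^ (b ∸ a) ℕ.* p ^ a ∎)
    where open ≡-Reasoning

  k≤vp⇒p^k∣ : ∀ {r x k} → k ≤ vp p r x → p ^ k ∣ x
  k≤vp⇒p^k∣ {r} {x} k≤vp = ℕ.∣-trans (p^-mono-∣ k≤vp) (p^vp∣ r x)

∤⇒coprime : ∀ {p u} → Prime p → ¬ p ∣ u → Coprime u p
∤⇒coprime p-prime p∤u (d∣u , d∣p) with prime⇒irreducible p-prime d∣p
... | inj₁ d≡1 = d≡1
... | inj₂ refl = contradiction d∣u p∤u

coprime-^ʳ : ∀ {u p} r → Coprime u p → Coprime u (p ^ r)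
coprime-^ʳ zero    u⊥p (_ , d∣1) = ℕ.∣1⇒≡1 d∣1
coprime-^ʳ {p = p} (suc r) u⊥p {d} (d∣u , d∣p*p^r) =
  coprime-^ʳ r u⊥p (d∣u , coprime-divisor d⊥p d∣p*p^r)
  where
  d⊥p : Coprime d p
  d⊥p (e∣d , e∣p) = u⊥p (ℕ.∣-trans e∣d d∣u , e∣p)

module _ {p : ℕ} (p-prime : Prime p) where

  unit-cofactor : ∀ {r x} → vp p r x < r →
                  ∃ λ u → x ≡ u ℕ.* p ^ vp p r x × Unit (p ^ r) (+ u)
  unit-cofactor {r} {x} v<r with p^vp∣ p r x
  ... | ℕ.divides u x≡u*p^v = u , x≡u*p^v , coprime⇒unit (coprime-^ʳ r (∤⇒coprime p-prime p∤u))
    where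
    p∤u : ¬ p ∣ u
    p∤u (ℕ.divides c refl) = ℕ.<-irrefl refl
      (p^k∣⇒k≤vp p v<r (ℕ.divides c (trans x≡u*p^v (ℕ.*-assoc c p _))))

module _ {p : ℕ} (p-prime : Prime p) (r : ℕ) where

  private
    N : ℕ
    N = p ^ r

  ConjExp-pres-p^k∣ : ∀ {s i j k} → k ≤ vp p r s → ConjExp N s i j → p ^ k ∣ i → p ^ k ∣ j
  ConjExp-pres-p^k∣ {s} k≤vs =
    ConjExp-pres-∣ (p^-mono-∣ p (ℕ.≤-trans k≤vs (vp≤ p r s))) (k≤vp⇒p^k∣ p {r} k≤vs)

  vp≡⇒ConjExp : ∀ {s i j} → vp p r i < r → vp p r j ≡ vp p r i → ConjExp N s i j
  vp≡⇒ConjExp {s} {i} {j} vi<r vj≡vi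
    with unit-cofactor p-prime vi<r | unit-cofactor p-prime (subst (_< r) (sym vj≡vi) vi<r)
  ... | u , i≡u*P , (u⁻¹ , uu⁻¹≡1) | w , j≡w*P , w-unit =
    + w * u⁻¹ , 0ℤ , unit-* {a = + w} {u⁻¹} w-unit (unit-inverse (+ u) u⁻¹ uu⁻¹≡1) ,
    mod-sym (begin
      + w * u⁻¹ * (+ i + 0ℤ * + s)       ≡⟨ cong (λ t → + w * u⁻¹ * (t + 0ℤ * + s)) i≡uP ⟩
      + w * u⁻¹ * (+ u * + P + 0ℤ * + s) ≡⟨ lemma (+ w) u⁻¹ (+ u) (+ P) (+ s) ⟩
      + w * + P * (+ u * u⁻¹)         ≈⟨ *-congˡ-mod (+ w * + P) uu⁻¹≡1 ⟩
      + w * + P * 1ℤ                  ≡⟨ ℤ.*-identityʳ (+ w * + P) ⟩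
      + w * + P                       ≡⟨ ℤ.pos-* w P ⟨
      + (w ℕ.* P)                     ≡⟨ cong (λ v → + (w ℕ.* p ^ v)) vj≡vi ⟨
      + (w ℕ.* p ^ vp p r j)          ≡⟨ cong +_ j≡w*P ⟨
      + j                             ∎)
    where
    open ≈-Reasoning (mod-setoid N)
    P = p ^ vp p r i
    i≡uP : + i ≡ + u * + P
    i≡uP = trans (cong +_ i≡u*P) (ℤ.pos-* u P)
    lemma : ∀ w u⁻¹ u P s → w * u⁻¹ * (u * P + 0ℤ * s) ≡ w * P * (u * u⁻¹)
    lemma = solve-∀

  p^vs∣⇒≡l*s : ∀ {s} x → + (p ^ vp p r s) ∣ᶻ x → ∃ λ l → x ≡[ N ] l * + s
  p^vs∣⇒≡l*s {s} x p^vs∣x with ℕ.m≤n⇒m<n∨m≡n (vp≤ p r s)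
  ... | inj₂ vs≡r = 0ℤ , mod∣ (∣ᶻ-resp-≡ (lemma x (+ s)) (subst (λ v → + (p ^ v) ∣ᶻ x) vs≡r p^vs∣x))
    where lemma : ∀ x s → x ≡ x - 0ℤ * s
          lemma = solve-∀
  ... | inj₁ vs<r with unit-cofactor p-prime vs<r | p^vs∣x
  ...   | u , s≡u*P , (u⁻¹ , uu⁻¹≡1) | divides d x≡d*P = d * u⁻¹ , (begin
    x                        ≡⟨ x≡d*P ⟩
    d * + P                  ≡⟨ ℤ.*-identityʳ (d * + P) ⟨
    d * + P * 1ℤ             ≈⟨ *-congˡ-mod (d * + P) uu⁻¹≡1 ⟨
    d * + P * (+ u * u⁻¹)    ≡⟨ lemma d (+ P) (+ u) u⁻¹ ⟩
    d * u⁻¹ * (+ u * + P)    ≡⟨ cong (λ t → d * u⁻¹ * t) (trans (sym (ℤ.pos-* u P)) (cong +_ (sym s≡u*P))) ⟩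
    d * u⁻¹ * + s            ∎)
    where
    open ≈-Reasoning (mod-setoid N)
    P = p ^ vp p r s
    lemma : ∀ d P u u⁻¹ → d * P * (u * u⁻¹) ≡ d * u⁻¹ * (u * P)
    lemma = solve-∀

  vp≤⇒ConjExp : ∀ {s i j} → vp p r s ≤ vp p r i → vp p r s ≤ vp p r j → ConjExp N s i j
  vp≤⇒ConjExp {s} {i} {j} vs≤vi vs≤vj with p^vs∣⇒≡l*s (+ j - + i)
    (∣m∣n⇒∣m-n (∣ᵤ⇒∣ {i = + j} (k≤vp⇒p^k∣ p {r} vs≤vj)) (∣ᵤ⇒∣ {i = + i} (k≤vp⇒p^k∣ p {r} vs≤vi)))
  ... | l , j-i≡ls = 1ℤ , l , (1ℤ , mod-reflexive refl) , (begin
    + j                       ≡⟨ lemma (+ i) (+ j) ⟩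
    + i + (+ j - + i)         ≈⟨ +-congˡ-mod (+ i) j-i≡ls ⟩
    + i + l * + s             ≡⟨ ℤ.*-identityˡ _ ⟨
    1ℤ * (+ i + l * + s)      ∎)
    where
    open ≈-Reasoning (mod-setoid N)
    lemma : ∀ i j → j ≡ i + (j - i)
    lemma = solve-∀

  ConjExp⇔vp≡ : ∀ {s i j} → vp p r i < vp p r s → ConjExp N s i j ⇔ vp p r j ≡ vp p r i
  ConjExp⇔vp≡ {s} {i} {j} vi<vs = mk⇔ vp≡ (vp≡⇒ConjExp vi<r)
    where
    vi<r : vp p r i < r
    vi<r = ℕ.<-≤-trans vi<vs (vp≤ p r s)
    vp≡ : ConjExp N s i j → vp p r j ≡ vp p r i
    vp≡ c = ℕ.≤-antisym vj≤vi vi≤vj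
      where
      vi≤vj : vp p r i ≤ vp p r j
      vi≤vj = p^k∣⇒k≤vp p (vp≤ p r i) (ConjExp-pres-p^k∣ (ℕ.<⇒≤ vi<vs) c (p^vp∣ p r i))
      vj≤vi : vp p r j ≤ vp p r i
      vj≤vi = ℕ.≮⇒≥ λ vi<vj → ℕ.<-irrefl refl
        (p^k∣⇒k≤vp p vi<r (ConjExp-pres-p^k∣ vi<vs (ConjExp-sym c) (k≤vp⇒p^k∣ p {r} vi<vj)))

  ConjExp⇔vp≥ : ∀ {s i j} → vp p r s ≤ vp p r i → ConjExp N s i j ⇔ vp p r s ≤ vp p r j
  ConjExp⇔vp≥ {s} vs≤vi = mk⇔
    (λ c → p^k∣⇒k≤vp p (vp≤ p r s) (ConjExp-pres-p^k∣ ℕ.≤-refl c (k≤vp⇒p^k∣ p {r} vs≤vi)))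
    (vp≤⇒ConjExp vs≤vi)

theorem3p4 : (p r i σ : ℕ) → Prime p → ¬ (2 ∣ p) → 1 ≤ r →
    IsElt (p ^ r) (i , σ) →
    (vp p r i < vp p r (σ ∸ 1) →
      (j τ : ℕ) → Conj (p ^ r) (i , σ) (j , τ) ⇔
        (IsElt (p ^ r) (j , τ) × τ ≡ σ × vp p r j ≡ vp p r i))
    × (vp p r (σ ∸ 1) ≤ vp p r i →
      (j τ : ℕ) → Conj (p ^ r) (i , σ) (j , τ) ⇔
        (IsElt (p ^ r) (j , τ) × τ ≡ σ × vp p r (σ ∸ 1) ≤ vp p r j))
theorem3p4 p r i σ p-prime _ 1≤r x∈K =
    (λ vi<vs j τ → (⇔-id _ ×-⇔ ⇔-id _ ×-⇔ ConjExp⇔vp≡ p-prime r vi<vs) ⇔-∘ conj⇔ 1<p^r x∈K)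
  , (λ vs≤vi j τ → (⇔-id _ ×-⇔ ⇔-id _ ×-⇔ ConjExp⇔vp≥ p-prime r vs≤vi) ⇔-∘ conj⇔ 1<p^r x∈K)
  where
  1<p^r : 1 < p ^ r
  1<p^r = ℕ.^-monoʳ-< p (ℕ.nonTrivial⇒n>1 p {{prime⇒nonTrivial p-prime}}) 1≤r
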